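{- There are infinitely many pairs $(y,w)$, with $y$ a positive integer and $w$ a binary word, such that $(y^2)_F = w\uparrow 2$.
   Context: Let $F_0=0$, $F_1=1$, $F_{i+1}=F_i+F_{i-1}$ be the Fibonacci numbers. Every integer $m\ge 1$ can be written uniquely (Zeckendorf) as $m=\sum_{2\le i\le t} e_i F_i$ with $e_i\in\{0,1\}$, $e_t=1$, and $e_ie_{i+1}\ne 1$ for all $i\ge 2$; its Fibonacci representation is the binary word $(m)_F=e_te_{t-1}\cdots e_2$ (most significant digit first). For a word $w$, $w\uparrow n$ denotes the concatenation of $n$ copies of $w$. -}

module Defs where

open import Data.Nat using (ℕ; zero; suc; _+_; _*_)
open import Data.Bool using (Bool; true; false)
open import Data.List using (List; []; _∷_; _++_; length)
open import Data.Product using (_×_)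
open import Data.Unit using (⊤)
open import Data.Empty using (⊥)
open import Relation.Binary.PropositionalEquality using (_≡_)

F : ℕ → ℕ
F zero = 0
F (suc zero) = 1
F (suc (suc i)) = F (suc i) + F i

-- Binary words, most significant digit first.
Word : Set
Word = List Bool

bit : Bool → ℕ
bit true = 1
bit false = 0

-- value of e_t ... e_2 : the digit at position k (counting from the right,
-- starting at 0) has weight F (k + 2).
fibVal : Word → ℕ
fibVal [] = 0
fibVal (b ∷ w) = bit b * F (length w + 2) + fibVal w

NoAdj11 : Word → Set
NoAdj11 [] = ⊤
NoAdj11 (_ ∷ []) = ⊤
NoAdj11 (true ∷ true ∷ w) = ⊥
NoAdj11 (_ ∷ b ∷ w) = NoAdj11 (b ∷ w)

LeadsWith1 : Word → Set
LeadsWith1 (true ∷ _) = ⊤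
LeadsWith1 _ = ⊥

-- (m)_F ≡ w : w is the Zeckendorf (Fibonacci) representation of m
-- (unique by Zeckendorf's theorem, for m ≥ 1).
IsFibRep : ℕ → Word → Set
IsFibRep m w = LeadsWith1 w × NoAdj11 w × fibVal w ≡ m

_↑_ : Word → ℕ → Word
w ↑ zero = []
w ↑ suc n = w ++ (w ↑ n)

{-# OPTIONS --safe #-}
-- Put n = 11 + 12m, q = F (n + 1), r = F n, and take the words
--   (y)_F = (100100100100)^m 100100101000   and   w = (100100000000)^m 100100000010.
-- By the addition law F (1 + s + a) = F (1 + a) F (1 + s) + F a F s, prepending u to a word of length
-- 1 + s adds F (1 + s) A₁ + F s A to the value, where A and A₁ are the values of u and of u shifted by
-- one place. So y, the value A of w and the value A₁ of w shifted by one place satisfy affine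
-- recurrences in (q, r), solved by 2y = 3q + 2r + 2, 20A = 29q + 18r + 22, 20A₁ = 47q + 29r + 31;
-- and the value of w w is q A₁ + r A + A, which Cassini's identity r (q + r) = q² + 1 (n odd) turns into y².
module Submission where

open import Defs
open import Data.Nat using (ℕ; zero; suc; _+_; _*_; _≤_; _<_; _>_; _≥_; s≤s; z≤n)
open import Data.Nat.Properties
  using (+-assoc; +-cancelʳ-≡; *-cancelˡ-≡; ≤-trans; ≤-refl; <⇒≤; m≤m+n; m≤m*n; +-monoˡ-≤; module ≤-Reasoning)
open import Data.Nat.Tactic.RingSolver using (solve; solve-∀)
open import Data.Bool using (Bool; true; false)
open import Data.List using ([]; _∷_; _++_; length)
open import Data.List.Properties using (length-++; ++-identityʳ)
open import Data.Product using (Σ; _×_; _,_)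
open import Data.Unit using (tt)
open import Relation.Binary.PropositionalEquality
  using (_≡_; refl; sym; trans; cong; cong₂; subst; module ≡-Reasoning)

-- The value of w followed by n zeros.
fibValFrom : ℕ → Word → ℕ
fibValFrom n [] = 0
fibValFrom n (b ∷ w) = bit b * F (n + (length w + 2)) + fibValFrom n w

fibValFrom-zero : ∀ w → fibValFrom 0 w ≡ fibVal w
fibValFrom-zero [] = refl
fibValFrom-zero (b ∷ w) = cong (bit b * F (length w + 2) +_) (fibValFrom-zero w)

fibValFrom-++ : ∀ n u w → fibValFrom n (u ++ w) ≡ fibValFrom (n + length w) u + fibValFrom n w
fibValFrom-++ n [] w = refl
fibValFrom-++ n (b ∷ u) w = begin
    bit b * F (n + (length (u ++ w) + 2)) + fibValFrom n (u ++ w)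
  ≡⟨ cong₂ (λ i v → bit b * F i + v) index (fibValFrom-++ n u w) ⟩
    bit b * F (n + length w + (length u + 2)) + (fibValFrom (n + length w) u + fibValFrom n w)
  ≡⟨ sym (+-assoc (bit b * F (n + length w + (length u + 2))) _ _) ⟩
    bit b * F (n + length w + (length u + 2)) + fibValFrom (n + length w) u + fibValFrom n w
  ∎
  where
  open ≡-Reasoning
  index : n + (length (u ++ w) + 2) ≡ n + length w + (length u + 2)
  index = trans (cong (λ k → n + (k + 2)) (length-++ u)) (reorder n (length u) (length w))
    where
    reorder : ∀ a b c → a + ((b + c) + 2) ≡ a + c + (b + 2)
    reorder = solve-∀

F-suc-+ : ∀ s a → F (suc s + a) ≡ F (suc a) * F (suc s) + F a * F s
F-suc-+ zero a = units (F (suc a)) (F a)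
  where
  units : ∀ x y → x ≡ x * 1 + y * 0
  units = solve-∀
F-suc-+ (suc zero) a = comm (F (suc a)) (F a)
  where
  comm : ∀ x y → x + y ≡ x * 1 + y * 1
  comm = solve-∀
F-suc-+ (suc (suc s)) a =
  trans (cong₂ _+_ (F-suc-+ (suc s) a) (F-suc-+ s a)) (collect (F (suc a)) (F a) (F (suc s)) (F s))
  where
  collect : ∀ x y p q → (x * (p + q) + y * p) + (x * p + y * q) ≡ x * ((p + q) + p) + y * (p + q)
  collect = solve-∀

1≤F[1+n] : ∀ n → 1 ≤ F (suc n)
1≤F[1+n] zero = ≤-refl
1≤F[1+n] (suc n) = ≤-trans (1≤F[1+n] n) (m≤m+n (F (suc n)) (F n))

fibValFrom-suc : ∀ s w → fibValFrom (suc s) w ≡ F (suc s) * fibValFrom 1 w + F s * fibValFrom 0 w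
fibValFrom-suc s [] = zeros (F (suc s)) (F s)
  where
  zeros : ∀ x y → 0 ≡ x * 0 + y * 0
  zeros = solve-∀
fibValFrom-suc s (b ∷ w) =
  trans (cong₂ (λ f v → bit b * f + v) (F-suc-+ s (length w + 2)) (fibValFrom-suc s w))
        (collect (bit b) (F (suc (length w + 2))) (F (length w + 2)) (F (suc s)) (F s)
                 (fibValFrom 1 w) (fibValFrom 0 w))
  where
  collect : ∀ c f₁ f₀ x y v₁ v₀ → c * (f₁ * x + f₀ * y) + (x * v₁ + y * v₀)
                                ≡ x * (c * f₁ + v₁) + y * (c * f₀ + v₀)
  collect = solve-∀

fibValFrom-prepend : ∀ k u w {s} → k + length w ≡ suc s →
  fibValFrom k (u ++ w) ≡ F (suc s) * fibValFrom 1 u + F s * fibValFrom 0 u + fibValFrom k w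
fibValFrom-prepend k u w {s} k+|w|≡1+s =
  trans (fibValFrom-++ k u w)
        (cong (_+ fibValFrom k w) (trans (cong (λ n → fibValFrom n u) k+|w|≡1+s) (fibValFrom-suc s u)))

cassini-even : ∀ k → F (1 + k * 2) * F (1 + k * 2) ≡ F (k * 2) * F (2 + k * 2) + 1
cassini-odd  : ∀ k → F (1 + k * 2) * F (3 + k * 2) ≡ F (2 + k * 2) * F (2 + k * 2) + 1

cassini-even zero = refl
cassini-even (suc k) = flip (F (2 + k * 2)) (F (1 + k * 2)) (cassini-odd k)
  where
  flip : ∀ a b → b * (a + b) ≡ a * a + 1 → (a + b) * (a + b) ≡ a * ((a + b) + a) + 1
  flip a b h = begin
      (a + b) * (a + b)           ≡⟨ solve (a ∷ b ∷ []) ⟩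
      a * a + a * b + b * (a + b) ≡⟨ cong (a * a + a * b +_) h ⟩
      a * a + a * b + (a * a + 1) ≡⟨ solve (a ∷ b ∷ []) ⟩
      a * ((a + b) + a) + 1       ∎
    where open ≡-Reasoning
cassini-odd k = flip (F (1 + k * 2)) (F (k * 2)) (cassini-even k)
  where
  flip : ∀ a b → a * a ≡ b * (a + b) + 1 → a * ((a + b) + a) ≡ (a + b) * (a + b) + 1
  flip a b h = begin
      a * ((a + b) + a)                 ≡⟨ solve (a ∷ b ∷ []) ⟩
      a * b + a * a + a * a             ≡⟨ cong (a * b + a * a +_) h ⟩
      a * b + a * a + (b * (a + b) + 1) ≡⟨ solve (a ∷ b ∷ []) ⟩
      (a + b) * (a + b) + 1             ∎
    where open ≡-Reasoning

I O : Bool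
I = true
O = false

u₀ t₀ v₀ s₀ : Word
u₀ = I ∷ O ∷ O ∷ I ∷ O ∷ O ∷ O ∷ O ∷ O ∷ O ∷ O ∷ O ∷ []
t₀ = I ∷ O ∷ O ∷ I ∷ O ∷ O ∷ O ∷ O ∷ O ∷ O ∷ I ∷ O ∷ []
v₀ = I ∷ O ∷ O ∷ I ∷ O ∷ O ∷ I ∷ O ∷ O ∷ I ∷ O ∷ O ∷ []
s₀ = I ∷ O ∷ O ∷ I ∷ O ∷ O ∷ I ∷ O ∷ I ∷ O ∷ O ∷ O ∷ []

halfWord rootWord : ℕ → Word
halfWord zero = t₀
halfWord (suc m) = u₀ ++ halfWord m
rootWord zero = s₀
rootWord (suc m) = v₀ ++ rootWord m

length-halfWord : ∀ m → length (halfWord m) ≡ 12 + m * 12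
length-halfWord zero = refl
length-halfWord (suc m) = cong (12 +_) (length-halfWord m)

length-rootWord : ∀ m → length (rootWord m) ≡ 12 + m * 12
length-rootWord zero = refl
length-rootWord (suc m) = cong (12 +_) (length-rootWord m)

q r : ℕ → ℕ
q m = F (12 + m * 12)
r m = F (11 + m * 12)

q-suc : ∀ m → q (suc m) ≡ q m * 233 + r m * 144
q-suc m = F-suc-+ 12 (11 + m * 12)

r-suc : ∀ m → r (suc m) ≡ q m * 144 + r m * 89
r-suc m = F-suc-+ 11 (11 + m * 12)

cassini-q-r : ∀ m → r m * (q m + r m) ≡ q m * q m + 1
cassini-q-r m = subst (λ n → F n * F (2 + n) ≡ F (1 + n) * F (1 + n) + 1)
                      (odd-index m) (cassini-odd (5 + m * 6))
  where
  odd-index : ∀ n → 1 + (5 + n * 6) * 2 ≡ 11 + n * 12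
  odd-index = solve-∀

closed-form : ∀ {a b} (X : ℕ → ℕ) (c α β γ : ℕ) →
  (∀ m → X (suc m) ≡ q m * a + r m * b + X m) →
  c * X 0 ≡ α * q 0 + β * r 0 + γ →
  c * a + α ≡ α * 233 + β * 144 →
  c * b + β ≡ α * 144 + β * 89 →
  ∀ m → c * X m ≡ α * q m + β * r m + γ
closed-form X c α β γ step base ha hb zero = base
closed-form {a} {b} X c α β γ step base ha hb (suc m) = begin
    c * X (suc m)
  ≡⟨ cong (c *_) (step m) ⟩
    c * (q m * a + r m * b + X m)
  ≡⟨ distrib (q m) (r m) (X m) ⟩
    q m * (c * a) + r m * (c * b) + c * X m
  ≡⟨ cong (q m * (c * a) + r m * (c * b) +_) (closed-form X c α β γ step base ha hb m) ⟩
    q m * (c * a) + r m * (c * b) + (α * q m + β * r m + γ)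
  ≡⟨ collect (q m) (r m) ⟩
    q m * (c * a + α) + r m * (c * b + β) + γ
  ≡⟨ cong₂ (λ s t → q m * s + r m * t + γ) ha hb ⟩
    q m * (α * 233 + β * 144) + r m * (α * 144 + β * 89) + γ
  ≡⟨ regroup (q m) (r m) ⟩
    α * (q m * 233 + r m * 144) + β * (q m * 144 + r m * 89) + γ
  ≡⟨ sym (cong₂ (λ s t → α * s + β * t + γ) (q-suc m) (r-suc m)) ⟩
    α * q (suc m) + β * r (suc m) + γ
  ∎
  where
  open ≡-Reasoning
  distrib : ∀ x y z → c * (x * a + y * b + z) ≡ x * (c * a) + y * (c * b) + c * z
  distrib x y z = solve (x ∷ y ∷ z ∷ a ∷ b ∷ c ∷ [])
  collect : ∀ x y → x * (c * a) + y * (c * b) + (α * x + β * y + γ)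
                  ≡ x * (c * a + α) + y * (c * b + β) + γ
  collect x y = solve (x ∷ y ∷ a ∷ b ∷ c ∷ α ∷ β ∷ γ ∷ [])
  regroup : ∀ x y → x * (α * 233 + β * 144) + y * (α * 144 + β * 89) + γ
                  ≡ α * (x * 233 + y * 144) + β * (x * 144 + y * 89) + γ
  regroup x y = solve (x ∷ y ∷ α ∷ β ∷ γ ∷ [])

half half₁ root : ℕ → ℕ
half m = fibValFrom 0 (halfWord m)
half₁ m = fibValFrom 1 (halfWord m)
root m = fibValFrom 0 (rootWord m)

half-suc : ∀ m → half (suc m) ≡ q m * 466 + r m * 288 + half m
half-suc m = fibValFrom-prepend 0 u₀ (halfWord m) (length-halfWord m)

half₁-suc : ∀ m → half₁ (suc m) ≡ q m * 754 + r m * 466 + half₁ m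
half₁-suc m = trans (fibValFrom-prepend 1 u₀ (halfWord m) (cong suc (length-halfWord m)))
                    (collect (q m) (r m) (half₁ m))
  where
  collect : ∀ x y z → (x + y) * 466 + x * 288 + z ≡ x * 754 + y * 466 + z
  collect = solve-∀

root-suc : ∀ m → root (suc m) ≡ q m * 492 + r m * 304 + root m
root-suc m = fibValFrom-prepend 0 v₀ (rootWord m) (length-rootWord m)

half-closed : ∀ m → 20 * half m ≡ 29 * q m + 18 * r m + 22
half-closed = closed-form half 20 29 18 22 half-suc refl refl refl

half₁-closed : ∀ m → 20 * half₁ m ≡ 47 * q m + 29 * r m + 31
half₁-closed = closed-form half₁ 20 47 29 31 half₁-suc refl refl refl

root-closed : ∀ m → 2 * root m ≡ 3 * q m + 2 * r m + 2
root-closed = closed-form root 2 3 2 2 root-suc refl refl refl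

-- Cleared of denominators, the two sides differ by 40 (a * a + 1 − b * (a + b)).
square-identity : ∀ a b x x₁ y →
  b * (a + b) ≡ a * a + 1 →
  20 * x ≡ 29 * a + 18 * b + 22 →
  20 * x₁ ≡ 47 * a + 29 * b + 31 →
  2 * y ≡ 3 * a + 2 * b + 2 →
  a * x₁ + b * x + x ≡ y * y
square-identity a b x x₁ y cassini hx hx₁ hy =
  *-cancelˡ-≡ _ _ 400 (+-cancelʳ-≡ (40 * (a * a + 1)) _ _ (begin
    400 * (a * x₁ + b * x + x) + 40 * (a * a + 1)
  ≡⟨ solve (a ∷ b ∷ x ∷ x₁ ∷ []) ⟩
    20 * a * (20 * x₁) + 20 * (b + 1) * (20 * x) + 40 * (a * a + 1)
  ≡⟨ cong₂ _+_ (cong₂ (λ s t → 20 * a * s + 20 * (b + 1) * t) hx₁ hx) (cong (40 *_) (sym cassini)) ⟩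
    20 * a * (47 * a + 29 * b + 31) + 20 * (b + 1) * (29 * a + 18 * b + 22) + 40 * (b * (a + b))
  ≡⟨ solve (a ∷ b ∷ []) ⟩
    100 * ((3 * a + 2 * b + 2) * (3 * a + 2 * b + 2)) + 40 * (a * a + 1)
  ≡⟨ cong (λ s → 100 * (s * s) + 40 * (a * a + 1)) (sym hy) ⟩
    100 * (2 * y * (2 * y)) + 40 * (a * a + 1)
  ≡⟨ solve (a ∷ y ∷ []) ⟩
    400 * (y * y) + 40 * (a * a + 1)
  ∎))
  where open ≡-Reasoning

value-halfWord↑2 : ∀ m → fibVal (halfWord m ↑ 2) ≡ root m * root m
value-halfWord↑2 m = begin
    fibVal (halfWord m ++ (halfWord m ++ []))
  ≡⟨ cong (λ w → fibVal (halfWord m ++ w)) (++-identityʳ (halfWord m)) ⟩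
    fibVal (halfWord m ++ halfWord m)
  ≡⟨ sym (fibValFrom-zero (halfWord m ++ halfWord m)) ⟩
    fibValFrom 0 (halfWord m ++ halfWord m)
  ≡⟨ fibValFrom-prepend 0 (halfWord m) (halfWord m) (length-halfWord m) ⟩
    q m * half₁ m + r m * half m + half m
  ≡⟨ square-identity (q m) (r m) (half m) (half₁ m) (root m)
                     (cassini-q-r m) (half-closed m) (half₁-closed m) (root-closed m) ⟩
    root m * root m
  ∎
  where open ≡-Reasoning

NoAdj11-false∷ : ∀ w → NoAdj11 w → NoAdj11 (false ∷ w)
NoAdj11-false∷ [] _ = tt
NoAdj11-false∷ (_ ∷ _) h = h

NoAdj11-halfWord-++ : ∀ m w → NoAdj11 w → NoAdj11 (halfWord m ++ w)
NoAdj11-halfWord-++ zero w h = NoAdj11-false∷ w h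
NoAdj11-halfWord-++ (suc m) w h = NoAdj11-false∷ (halfWord m ++ w) (NoAdj11-halfWord-++ m w h)

LeadsWith1-halfWord-++ : ∀ m w → LeadsWith1 (halfWord m ++ w)
LeadsWith1-halfWord-++ zero w = tt
LeadsWith1-halfWord-++ (suc m) w = tt

m<root : ∀ m → m < root m
m<root zero = s≤s z≤n
m<root (suc m) = begin-strict
    suc m                              <⟨ s≤s (m<root m) ⟩
    1 + root m                         ≤⟨ +-monoˡ-≤ (root m) 1≤step ⟩
    q m * 492 + r m * 304 + root m     ≡⟨ sym (root-suc m) ⟩
    root (suc m)                       ∎
  where
  open ≤-Reasoning
  1≤step : 1 ≤ q m * 492 + r m * 304
  1≤step = ≤-trans (1≤F[1+n] (11 + m * 12)) (≤-trans (m≤m*n (q m) 492) (m≤m+n _ _))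

mainTheorem16 : (N : ℕ) → Σ ℕ (λ y → Σ Word (λ w →
    y ≥ N × y > 0 × IsFibRep (y * y) (w ↑ 2)))
mainTheorem16 N =
  root N , halfWord N , <⇒≤ (m<root N) , ≤-trans (s≤s z≤n) (m<root N) ,
  LeadsWith1-halfWord-++ N _ ,
  NoAdj11-halfWord-++ N _ (NoAdj11-halfWord-++ N [] tt) ,
  value-halfWord↑2 N
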